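{- Let $\mathcal{C}$ be a clutter with vertex set $\{x_1,\dots,x_n\}$ that is an $f$-forest. Then $\Delta_{\mathcal{C}}$ is shellable.
   Context: A clutter on $X=\{x_1,\dots,x_n\}$ is a family of subsets of $X$ (edges) none contained in another. An edge $E$ of a clutter is an $f$-leaf if $E$ is the only edge, or if there is an edge $H\neq E$ such that $E\cap E'\subset E\cap H$ for all edges $E'\neq E$. A clutter is an $f$-forest if every nonempty subclutter (a clutter whose edge set is a nonempty subset of the edge set), including the clutter itself, contains an $f$-leaf. $\Delta_{\mathcal{C}}$ is the Stanley–Reisner complex on $X$ of the edge ideal $I(\mathcal{C})\subset k[x_1,\dots,x_n]$ generated by the squarefree monomials $\prod_{x\in S}x$ for edges $S$; its facets are the complements of the minimal vertex covers. A simplicial complex is shellable if its facets can be ordered $F_1,\dots,F_s$ so that for all $1\le i<j\le s$ there exist $v\in F_j\setminus F_i$ and $\ell\in\{1,\dots,j-1\}$ with $F_j\setminus F_\ell=\{v\}$ (non-pure shellability). -}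

module Defs where

open import Data.Nat using (ℕ)
open import Data.Fin using (Fin; _<_)
open import Data.Fin.Subset using (Subset; _∈_; _⊆_; _∩_; _─_; ⁅_⁆)
open import Data.List using (List; [])
open import Data.List.Membership.Propositional using () renaming (_∈_ to _∈ₗ_)
open import Data.List.Relation.Unary.Unique.Propositional using (Unique)
open import Data.List.Relation.Binary.Sublist.Propositional using ()
  renaming (_⊆_ to _⊑_)
open import Data.Product using (Σ; ∃; _×_)
open import Data.Sum using (_⊎_)
open import Relation.Nullary using (¬_)
open import Relation.Binary.PropositionalEquality using (_≡_; _≢_)
open import Function using (Injective)

IsClutter : {n : ℕ} → List (Subset n) → Set
IsClutter {n} edges =
  Unique edges ×
  (∀ {E E′ : Subset n} → E ∈ₗ edges → E′ ∈ₗ edges → E ⊆ E′ → E ≡ E′)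

record Clutter (n : ℕ) : Set where
  constructor clutter
  field
    edges     : List (Subset n)
    isClutter : IsClutter edges
open Clutter public

IsFLeaf : {n : ℕ} → List (Subset n) → Subset n → Set
IsFLeaf {n} edges E =
  E ∈ₗ edges ×
  ( (∀ {E′} → E′ ∈ₗ edges → E′ ≡ E)
  ⊎ Σ (Subset n) λ H → H ∈ₗ edges × H ≢ E ×
      (∀ {E′} → E′ ∈ₗ edges → E′ ≢ E → (E ∩ E′) ⊆ (E ∩ H)))

IsFForest : {n : ℕ} → Clutter n → Set
IsFForest {n} C =
  ∀ (sub : List (Subset n)) → sub ⊑ edges C → sub ≢ [] →
  Σ (Subset n) λ E → IsFLeaf sub E

-- Stanley–Reisner complex of the edge ideal I(C): a face is a set of vertices
-- whose squarefree monomial is not in I(C), i.e. containing no edge.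
IsFace : {n : ℕ} → Clutter n → Subset n → Set
IsFace C σ = ∀ {E} → E ∈ₗ edges C → ¬ (E ⊆ σ)

IsFacet : {n : ℕ} → Clutter n → Subset n → Set
IsFacet C F = IsFace C F × (∀ {σ} → IsFace C σ → F ⊆ σ → σ ≡ F)

IsShellable : {n : ℕ} → Clutter n → Set
IsShellable {n} C =
  Σ ℕ λ s → Σ (Fin s → Subset n) λ F →
    Injective _≡_ _≡_ F ×
    (∀ i → IsFacet C (F i)) ×
    (∀ G → IsFacet C G → ∃ λ i → F i ≡ G) ×
    (∀ (i j : Fin s) → i < j →
      Σ (Fin n) λ v → v ∈ (F j ─ F i) ×
        Σ (Fin s) λ ℓ → ℓ < j × (F j ─ F ℓ) ≡ ⁅ v ⁆)

{-# OPTIONS --safe #-}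

-- A nonempty f-forest has an f-leaf E with witness H. If E ⊆ H, the edge H is redundant and can be
-- dropped without changing the complex; otherwise any v ∈ E ∖ H lies in no edge but E, since
-- E ∩ E′ ⊆ E ∩ H for every other edge E′. Such a free vertex is a shedding vertex: the facets
-- containing v are v joined with the facets of the link (edges E′ - v on V - v), the facets
-- avoiding v are E - v joined with the facets of the complex of the edges E′ ─ E with v ∉ E′ on
-- V ─ E, and listing the first family before the second is a shelling, because a facet F avoiding v
-- meets some facet containing v in F - u, for any u ∈ E outside a given earlier facet. Deleting a
-- fixed set from every edge keeps f-leaves f-leaves, so both smaller clutters are again f-forests
-- and induction on the number of vertices plus the number of edges finishes the proof.
module Submission where

open import Data.Empty using (⊥-elim)
open import Data.Fin.Base as Fin using (Fin; opposite)
open import Data.Fin.Properties using (any?; <-cmp; opposite-prop; opposite-involutive; toℕ<n)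
open import Data.Fin.Subset
open import Data.Fin.Subset.Properties
open import Data.List.Base using (List; []; _∷_; map; filter; length; lookup; _++_)
open import Data.List.Properties using (length-map; length-filter; filter-notAll)
open import Data.List.Membership.Propositional using (find; lose) renaming (_∈_ to _∈ₗ_)
open import Data.List.Membership.Propositional.Properties
  using (∈-map⁺; ∈-map⁻; ∈-filter⁺; ∈-filter⁻; ∈-++⁺ˡ; ∈-++⁺ʳ; ∈-++⁻; ∈-lookup)
open import Data.List.Relation.Binary.Subset.Propositional using () renaming (_⊆_ to _⊆ₗ_)
import Data.List.Relation.Binary.Sublist.Propositional.Properties as Sublist
import Data.List.Relation.Binary.Subset.Propositional.Properties as ⊆ₗ
import Data.List.Relation.Unary.All as All
open import Data.List.Relation.Unary.Any as Any using (Any)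
open import Data.List.Relation.Unary.Any.Properties using (lookup-index)
open import Data.Nat.Base using (ℕ; _+_; _∸_; _<_; s≤s; z≤n)
open import Data.Nat.Properties using (∸-monoʳ-<; +-monoʳ-<; +-mono-<-≤; ≤-reflexive; ≤-trans)
open import Data.Product using (Σ; ∃; _×_; _,_; proj₁; proj₂)
open import Data.Sum using (_⊎_; inj₁; inj₂; [_,_]′)
open import Data.Bool.Properties using () renaming (_≟_ to _≟ᵇ_)
open import Data.Vec.Base using (_∷_; here; there)
open import Data.Vec.Properties using (≡-dec)
open import Function using (Injective; id; _∘_)
open import Induction.WellFounded using (Acc; acc)
open import Data.Nat.Induction using (<-wellFounded)
open import Relation.Binary.Definitions using (DecidableEquality; tri<; tri≈; tri>)
open import Relation.Binary.PropositionalEquality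
open import Relation.Nullary using (yes; no; ¬_; ¬?; _×-dec_)
open import Relation.Nullary.Decidable using (decidable-stable; map′)
open import Relation.Unary using (Decidable)

open import Defs

private variable
  n : ℕ
  x : Fin n
  p q r s : Subset n

_≟ₛ_ : DecidableEquality (Subset n)
_≟ₛ_ = ≡-dec _≟ᵇ_

x∈p─q⇒x∉q : ∀ (p q : Subset n) → x ∈ p ─ q → x ∉ q
x∈p─q⇒x∉q (_ ∷ p) (outside ∷ q) here      ()
x∈p─q⇒x∉q (_ ∷ p) (_       ∷ q) (there m) x∈q = x∈p─q⇒x∉q p q m (drop-there x∈q)

x∉p─p : ∀ (p : Subset n) → x ∉ p ─ p
x∉p─p p x∈p─p = x∈p─q⇒x∉q p p x∈p─p (p─q⊆p p p x∈p─p)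

x∉p⇒p⊆p-x : x ∉ p → p ⊆ p - x
x∉p⇒p⊆p-x x∉p y∈p = x∈p∧x≢y⇒x∈p-y y∈p λ { refl → x∉p y∈p }

x∈p⇒⁅x⁆⊆p : x ∈ p → ⁅ x ⁆ ⊆ p
x∈p⇒⁅x⁆⊆p {p = p} x∈p y∈⁅x⁆ = subst (_∈ p) (sym (x∈⁅y⁆⇒x≡y _ y∈⁅x⁆)) x∈p

p⊈q⇒∃ : p ⊈ q → ∃ λ x → x ∈ p × x ∉ q
p⊈q⇒∃ {p = p} {q = q} p⊈q with any? (λ x → x ∈? p ×-dec ¬? (x ∈? q))
... | yes witness = witness
... | no  none    = ⊥-elim (p⊈q λ {x} x∈p → decidable-stable (x ∈? q) λ x∉q → none (x , x∈p , x∉q))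

∪-lub : p ⊆ r → q ⊆ r → p ∪ q ⊆ r
∪-lub {p = p} {q = q} p⊆r q⊆r x∈p∪q = [ p⊆r , q⊆r ]′ (x∈p∪q⁻ p q x∈p∪q)

∪-mono-⊆ : p ⊆ q → r ⊆ s → p ∪ r ⊆ q ∪ s
∪-mono-⊆ {q = q} {s = s} p⊆q r⊆s = ∪-lub (p⊆p∪q s ∘ p⊆q) (q⊆p∪q q s ∘ r⊆s)

─-monoˡ-⊆ : p ⊆ q → p ─ r ⊆ q ─ r
─-monoˡ-⊆ {p = p} {r = r} p⊆q x∈p─r =
  x∈p∧x∉q⇒x∈p─q (p⊆q (p─q⊆p p r x∈p─r)) (x∈p─q⇒x∉q p r x∈p─r)

p─q⊆r⇒p⊆r∪q : p ─ q ⊆ r → p ⊆ r ∪ q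
p─q⊆r⇒p⊆r∪q {q = q} {r = r} p─q⊆r {x} x∈p with x ∈? q
... | yes x∈q = q⊆p∪q r q x∈q
... | no  x∉q = p⊆p∪q q (p─q⊆r (x∈p∧x∉q⇒x∈p─q x∈p x∉q))

p⊆r∪q⇒p─q⊆r : p ⊆ r ∪ q → p ─ q ⊆ r
p⊆r∪q⇒p─q⊆r {p = p} {r = r} {q = q} p⊆r∪q x∈p─q =
  [ id , (λ x∈q → ⊥-elim (x∈p─q⇒x∉q p q x∈p─q x∈q)) ]′ (x∈p∪q⁻ r q (p⊆r∪q (p─q⊆p p q x∈p─q)))

p─q⊆r⇒q⊆r⇒p⊆r : p ─ q ⊆ r → q ⊆ r → p ⊆ r
p─q⊆r⇒q⊆r⇒p⊆r p─q⊆r q⊆r = ⊆-trans (p─q⊆r⇒p⊆r∪q p─q⊆r) (∪-lub id q⊆r)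

p─q⊆r⇒p─r⊆q : p ─ q ⊆ r → p ─ r ⊆ q
p─q⊆r⇒p─r⊆q {q = q} {r = r} p─q⊆r =
  p⊆r∪q⇒p─q⊆r (⊆-trans (p─q⊆r⇒p⊆r∪q p─q⊆r) (⊆-reflexive (∪-comm r q)))

∪-─-cancel : Empty (p ∩ q) → (p ∪ q) ─ q ≡ p
∪-─-cancel {p = p} {q = q} p∩q-empty = ⊆-antisym (p⊆r∪q⇒p─q⊆r id)
  λ x∈p → x∈p∧x∉q⇒x∈p─q (p⊆p∪q q x∈p) λ x∈q → p∩q-empty (_ , x∈p∩q⁺ (x∈p , x∈q))

─-∪-cancel : q ⊆ p → (p ─ q) ∪ q ≡ p
─-∪-cancel {q = q} {p = p} q⊆p = ⊆-antisym (∪-lub (p─q⊆p p q) q⊆p) (p─q⊆r⇒p⊆r∪q id)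

∪-─-∪-cancel : Empty (p ∩ r) → (p ∪ r) ─ (q ∪ r) ≡ p ─ q
∪-─-∪-cancel {p = p} {r = r} {q = q} p∩r-empty = begin
  (p ∪ r) ─ (q ∪ r)  ≡⟨ cong ((p ∪ r) ─_) (∪-comm q r) ⟩
  (p ∪ r) ─ (r ∪ q)  ≡⟨ p─q─r≡p─q∪r (p ∪ r) r q ⟨
  p ∪ r ─ r ─ q      ≡⟨ cong (_─ q) (∪-─-cancel p∩r-empty) ⟩
  p ─ q              ∎
  where open ≡-Reasoning

─-antimonoʳ-⊆ : r ⊆ s → p ─ s ⊆ p ─ r
─-antimonoʳ-⊆ {s = s} {p = p} r⊆s x∈p─s =
  x∈p∧x∉q⇒x∈p─q (p─q⊆p p s x∈p─s) (x∈p─q⇒x∉q p s x∈p─s ∘ r⊆s)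

p⊆q─r⇒Empty[p∩r] : p ⊆ q ─ r → Empty (p ∩ r)
p⊆q─r⇒Empty[p∩r] {p = p} {q = q} {r = r} p⊆q─r (x , x∈p∩r) =
  let (x∈p , x∈r) = x∈p∩q⁻ p r x∈p∩r in x∈p─q⇒x∉q q r (p⊆q─r x∈p) x∈r

─-preserves-∩⊆∩ : p ∩ q ⊆ p ∩ r → (p ─ s) ∩ (q ─ s) ⊆ (p ─ s) ∩ (r ─ s)
─-preserves-∩⊆∩ {p = p} {q = q} {r = r} {s = s} p∩q⊆p∩r x∈ =
  let (x∈p─s , x∈q─s) = x∈p∩q⁻ (p ─ s) (q ─ s) x∈
      x∈r = proj₂ (x∈p∩q⁻ p r (p∩q⊆p∩r (x∈p∩q⁺ (p─q⊆p p s x∈p─s , p─q⊆p q s x∈q─s))))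
  in x∈p∩q⁺ (x∈p─s , x∈p∧x∉q⇒x∈p─q x∈r (x∈p─q⇒x∉q p s x∈p─s))

IsFacetOf : (Subset n → Set) → Subset n → Set
IsFacetOf Φ F = Φ F × (∀ {σ} → Φ σ → F ⊆ σ → σ ≡ F)

IsFacetOf-resp : {Φ Ψ : Subset n → Set} → (∀ {σ} → Φ σ → Ψ σ) → (∀ {σ} → Ψ σ → Φ σ) →
                 ∀ {F} → IsFacetOf Φ F → IsFacetOf Ψ F
IsFacetOf-resp to from (ΦF , F-maximal) = to ΦF , λ Ψσ F⊆σ → F-maximal (from Ψσ) F⊆σ

DownClosed : (Subset n → Set) → Set
DownClosed {n} Φ = ∀ {σ τ : Subset n} → Φ τ → σ ⊆ τ → Φ σ

module _ {Φ : Subset n → Set} (Φ? : Decidable Φ) (Φ-down : DownClosed Φ) where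

  private
    grow : ∀ {σ} → Acc _<_ (n ∸ ∣ σ ∣) → Φ σ → ∃ λ F → IsFacetOf Φ F × σ ⊆ F
    grow {σ} (acc smaller) Φσ with any? (λ x → ¬? (x ∈? σ) ×-dec Φ? (σ ∪ ⁅ x ⁆))
    ... | yes (x , x∉σ , Φσ+x) =
      let (F , F-facet , σ+x⊆F) = grow (smaller (∸-monoʳ-< ∣σ∣<∣σ+x∣ (∣p∣≤n (σ ∪ ⁅ x ⁆)))) Φσ+x
      in F , F-facet , ⊆-trans (p⊆p∪q ⁅ x ⁆) σ+x⊆F
      where
      ∣σ∣<∣σ+x∣ : ∣ σ ∣ < ∣ σ ∪ ⁅ x ⁆ ∣
      ∣σ∣<∣σ+x∣ = p⊂q⇒∣p∣<∣q∣ (p⊆p∪q ⁅ x ⁆ , x , q⊆p∪q σ ⁅ x ⁆ (x∈⁅x⁆ x) , x∉σ)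
    ... | no unextendable = σ , (Φσ , maximal) , id
      where
      maximal : ∀ {τ} → Φ τ → σ ⊆ τ → τ ≡ σ
      maximal Φτ σ⊆τ = ⊆-antisym (λ {x} x∈τ → decidable-stable (x ∈? σ) λ x∉σ →
        unextendable (x , x∉σ , Φ-down Φτ (∪-lub σ⊆τ (x∈p⇒⁅x⁆⊆p x∈τ)))) σ⊆τ

  facet-above : ∀ {σ} → Φ σ → ∃ λ F → IsFacetOf Φ F × σ ⊆ F
  facet-above = grow (<-wellFounded _)

Attaches : (Subset n → Set) → Subset n → Subset n → Set
Attaches {n} 𝓔 F G = ∃ λ (v : Fin n) → v ∈ F ─ G × ∃ λ G′ → 𝓔 G′ × F ─ G′ ≡ ⁅ v ⁆

Attaches-mono : {𝓔 𝓔′ : Subset n → Set} → (∀ {G} → 𝓔 G → 𝓔′ G) →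
                ∀ {F G} → Attaches 𝓔 F G → Attaches 𝓔′ F G
Attaches-mono 𝓔⊆𝓔′ (v , v∈F─G , G′ , 𝓔G′ , F─G′≡v) = v , v∈F─G , G′ , 𝓔⊆𝓔′ 𝓔G′ , F─G′≡v

-- A shelling order read backwards: each facet attaches to all the facets after it in the list.
data ShellingOrder {n} : List (Subset n) → Set where
  []  : ShellingOrder []
  _∷_ : ∀ {F R} → (∀ {G} → G ∈ₗ R → Attaches (_∈ₗ R) F G) → ShellingOrder R →
        ShellingOrder (F ∷ R)

record Shelling {n} (𝓕 : Subset n → Set) : Set where
  field
    facets   : List (Subset n)
    sound    : ∀ {F} → F ∈ₗ facets → 𝓕 F
    complete : ∀ {F} → 𝓕 F → F ∈ₗ facets
    ordered  : ShellingOrder facets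

module _ {𝓕 𝓖 : Subset n → Set} where

  shelling-resp : (∀ {F} → 𝓕 F → 𝓖 F) → (∀ {F} → 𝓖 F → 𝓕 F) → Shelling 𝓕 → Shelling 𝓖
  shelling-resp to from sh = record
    { facets = facets ; sound = to ∘ sound ; complete = complete ∘ from ; ordered = ordered }
    where open Shelling sh

  ShellingOrder-map : (g : Subset n → Subset n) {R : List (Subset n)} →
    (∀ {τ τ′} → τ ∈ₗ R → τ′ ∈ₗ R → g τ ─ g τ′ ≡ τ ─ τ′) →
    ShellingOrder R → ShellingOrder (map g R)
  ShellingOrder-map g _ [] = []
  ShellingOrder-map g {τ ∷ R} g-diff (attaches ∷ ordered) =
    attaches′ ∷ ShellingOrder-map g (λ a b → g-diff (Any.there a) (Any.there b)) ordered
    where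
    attaches′ : ∀ {G} → G ∈ₗ map g R → Attaches (_∈ₗ map g R) (g τ) G
    attaches′ G∈ with ∈-map⁻ g G∈
    ... | τ′ , τ′∈R , refl with attaches τ′∈R
    ... | v , v∈τ─τ′ , τ″ , τ″∈R , τ─τ″≡v =
      v , subst (v ∈_) (sym (g-diff (Any.here refl) (Any.there τ′∈R))) v∈τ─τ′ ,
      g τ″ , ∈-map⁺ g τ″∈R , trans (g-diff (Any.here refl) (Any.there τ″∈R)) τ─τ″≡v

  shelling-map : (g : Subset n → Subset n) →
    (∀ {τ} → 𝓕 τ → 𝓖 (g τ)) →
    (∀ {ρ} → 𝓖 ρ → ∃ λ τ → 𝓕 τ × g τ ≡ ρ) →
    (∀ {τ τ′} → 𝓕 τ → 𝓕 τ′ → g τ ─ g τ′ ≡ τ ─ τ′) →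
    Shelling 𝓕 → Shelling 𝓖
  shelling-map g 𝓕⇒𝓖 𝓖⇒𝓕 g-diff sh = record
    { facets   = map g facets
    ; sound    = sound′
    ; complete = complete′
    ; ordered  = ShellingOrder-map g (λ a b → g-diff (sound a) (sound b)) ordered
    }
    where
    open Shelling sh
    sound′ : ∀ {ρ} → ρ ∈ₗ map g facets → 𝓖 ρ
    sound′ ρ∈ with ∈-map⁻ g ρ∈
    ... | τ , τ∈ , refl = 𝓕⇒𝓖 (sound τ∈)
    complete′ : ∀ {ρ} → 𝓖 ρ → ρ ∈ₗ map g facets
    complete′ 𝓖ρ with 𝓖⇒𝓕 𝓖ρ
    ... | τ , 𝓕τ , refl = ∈-map⁺ g (complete 𝓕τ)

ShellingOrder-++ : ∀ {A B : List (Subset n)} → ShellingOrder A → ShellingOrder B →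
  (∀ {F G} → F ∈ₗ A → G ∈ₗ B → Attaches (_∈ₗ B) F G) → ShellingOrder (A ++ B)
ShellingOrder-++ [] orderedB _ = orderedB
ShellingOrder-++ {A = F ∷ A} {B} (attachesA ∷ orderedA) orderedB across =
  attaches ∷ ShellingOrder-++ orderedA orderedB (across ∘ Any.there)
  where
  attaches : ∀ {G} → G ∈ₗ A ++ B → Attaches (_∈ₗ A ++ B) F G
  attaches G∈ with ∈-++⁻ A G∈
  ... | inj₁ G∈A = Attaches-mono ∈-++⁺ˡ (attachesA G∈A)
  ... | inj₂ G∈B = Attaches-mono (∈-++⁺ʳ A) (across (Any.here refl) G∈B)

-- The facets in 𝓕 are shelled first, then those in 𝓖.
shelling-++ : {𝓕 𝓖 : Subset n → Set} → Shelling 𝓕 → Shelling 𝓖 →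
  (∀ {F G} → 𝓖 F → 𝓕 G → Attaches 𝓕 F G) → Shelling (λ F → 𝓕 F ⊎ 𝓖 F)
shelling-++ sh𝓕 sh𝓖 across = record
  { facets   = 𝓖.facets ++ 𝓕.facets
  ; sound    = λ F∈ → [ inj₂ ∘ 𝓖.sound , inj₁ ∘ 𝓕.sound ]′ (∈-++⁻ 𝓖.facets F∈)
  ; complete = [ ∈-++⁺ʳ 𝓖.facets ∘ 𝓕.complete , ∈-++⁺ˡ ∘ 𝓖.complete ]′
  ; ordered  = ShellingOrder-++ 𝓖.ordered 𝓕.ordered λ F∈ G∈ →
      Attaches-mono 𝓕.complete (across (𝓖.sound F∈) (𝓕.sound G∈))
  }
  where
  module 𝓕 = Shelling sh𝓕
  module 𝓖 = Shelling sh𝓖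

ShellingOrder-lookup : ∀ {R : List (Subset n)} → ShellingOrder R → ∀ {i j} → i Fin.< j →
  Σ (Fin n) λ v → v ∈ lookup R i ─ lookup R j ×
    Σ (Fin (length R)) λ k → i Fin.< k × lookup R i ─ lookup R k ≡ ⁅ v ⁆
ShellingOrder-lookup {R = F ∷ R} (attaches ∷ _) {Fin.zero} {Fin.suc j} _
  with attaches (∈-lookup {xs = R} j)
... | v , v∈F─G , G′ , G′∈R , F─G′≡v =
  v , v∈F─G , Fin.suc (Any.index G′∈R) , s≤s z≤n ,
  subst (λ G → F ─ G ≡ ⁅ v ⁆) (lookup-index G′∈R) F─G′≡v
ShellingOrder-lookup (_ ∷ ordered) {Fin.suc i} {Fin.suc j} (s≤s i<j)
  with ShellingOrder-lookup ordered i<j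
... | v , v∈ , k , i<k , eq = v , v∈ , Fin.suc k , s≤s i<k , eq

opposite-< : ∀ {i j : Fin n} → i Fin.< j → opposite j Fin.< opposite i
opposite-< {n} {i} {j} i<j rewrite opposite-prop i | opposite-prop j =
  ∸-monoʳ-< (s≤s i<j) (toℕ<n j)

-- Indices are reversed, since shelling orders are listed backwards.
shelling⇒isShellable : (C : Clutter n) → Shelling (IsFacet C) → IsShellable C
shelling⇒isShellable {n} C sh =
  length facets , F , F-injective , (λ i → sound (∈-lookup (opposite i))) , F-complete , F-shells
  where
  open Shelling sh

  F : Fin (length facets) → Subset n
  F i = lookup facets (opposite i)

  F-shells : ∀ i j → i Fin.< j → Σ (Fin n) λ v → v ∈ F j ─ F i ×
             Σ (Fin (length facets)) λ ℓ → ℓ Fin.< j × F j ─ F ℓ ≡ ⁅ v ⁆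
  F-shells i j i<j with ShellingOrder-lookup ordered (opposite-< i<j)
  ... | v , v∈ , k , j′<k , eq =
    v , v∈ , opposite k ,
    subst (opposite k Fin.<_) (opposite-involutive j) (opposite-< j′<k) ,
    subst (λ k′ → F j ─ lookup facets k′ ≡ ⁅ v ⁆) (sym (opposite-involutive k)) eq

  F-injective : Injective _≡_ _≡_ F
  F-injective {i} {j} Fi≡Fj with <-cmp i j
  ... | tri≈ _ i≡j _ = i≡j
  ... | tri< i<j _ _ = let (v , v∈ , _) = F-shells i j i<j in
    ⊥-elim (x∉p─p (F j) (subst (λ G → v ∈ F j ─ G) Fi≡Fj v∈))
  ... | tri> _ _ j<i = let (v , v∈ , _) = F-shells j i j<i in
    ⊥-elim (x∉p─p (F i) (subst (λ G → v ∈ F i ─ G) (sym Fi≡Fj) v∈))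

  F-complete : ∀ G → IsFacet C G → ∃ λ i → F i ≡ G
  F-complete G G-facet = let G∈ = complete G-facet in
    opposite (Any.index G∈) ,
    trans (cong (lookup facets) (opposite-involutive (Any.index G∈))) (sym (lookup-index G∈))

-- Γ is isomorphic, via τ ↦ τ ∪ c and ρ ↦ ρ ─ c, to the faces of Δ satisfying P, an upward closed
-- family; facets then correspond to facets.
module FacetsOfJoin {n} {Δ Γ P : Subset n → Set} (c : Subset n)
  (P-upward   : ∀ {ρ ρ′} → P ρ → ρ ⊆ ρ′ → Δ ρ′ → P ρ′)
  (P⇒c⊆       : ∀ {ρ} → P ρ → c ⊆ ρ)
  (Γ-disjoint : ∀ {τ} → Γ τ → Empty (τ ∩ c))
  (join       : ∀ {τ} → Γ τ → Δ (τ ∪ c) × P (τ ∪ c))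
  (split      : ∀ {ρ} → Δ ρ → P ρ → Γ (ρ ─ c))
  where

  open ≡-Reasoning

  facet-join : ∀ {τ} → IsFacetOf Γ τ → IsFacetOf Δ (τ ∪ c)
  facet-join {τ} (Γτ , τ-maximal) = proj₁ (join Γτ) , λ {ρ} Δρ τ∪c⊆ρ →
    let Pρ = P-upward (proj₂ (join Γτ)) τ∪c⊆ρ Δρ
        τ⊆ρ─c = subst (_⊆ ρ ─ c) (∪-─-cancel (Γ-disjoint Γτ)) (─-monoˡ-⊆ τ∪c⊆ρ)
    in begin
      ρ            ≡⟨ ─-∪-cancel (P⇒c⊆ Pρ) ⟨
      (ρ ─ c) ∪ c  ≡⟨ cong (_∪ c) (τ-maximal (split Δρ Pρ) τ⊆ρ─c) ⟩
      τ ∪ c        ∎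

  facet-split : ∀ {ρ} → IsFacetOf Δ ρ → P ρ → IsFacetOf Γ (ρ ─ c)
  facet-split {ρ} (Δρ , ρ-maximal) Pρ = split Δρ Pρ , λ {τ} Γτ ρ─c⊆τ →
    let ρ⊆τ∪c = subst (_⊆ τ ∪ c) (─-∪-cancel (P⇒c⊆ Pρ)) (∪-mono-⊆ ρ─c⊆τ id)
    in begin
      τ            ≡⟨ ∪-─-cancel (Γ-disjoint Γτ) ⟨
      (τ ∪ c) ─ c  ≡⟨ cong (_─ c) (ρ-maximal (proj₁ (join Γτ)) ρ⊆τ∪c) ⟩
      ρ ─ c        ∎

  shelling-join : Shelling (IsFacetOf Γ) → Shelling (λ ρ → IsFacetOf Δ ρ × P ρ)
  shelling-join = shelling-map (_∪ c)
    (λ τ-facet → facet-join τ-facet , proj₂ (join (proj₁ τ-facet)))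
    (λ (ρ-facet , Pρ) → _ , facet-split ρ-facet Pρ , ─-∪-cancel (P⇒c⊆ Pρ))
    (λ τ-facet _ → ∪-─-∪-cancel (Γ-disjoint (proj₁ τ-facet)))

-- Δ_L restricted to the vertex set V; Δ_C is Independent (edges C) ⊤.
Independent : List (Subset n) → Subset n → Subset n → Set
Independent L V σ = σ ⊆ V × (∀ {E} → E ∈ₗ L → E ⊈ σ)

module _ {L : List (Subset n)} {V : Subset n} where

  independent? : Decidable (Independent L V)
  independent? σ = σ ⊆? V ×-dec map′ All.lookup All.tabulate (All.all? (λ E → ¬? (E ⊆? σ)) L)

  independent-down : DownClosed (Independent L V)
  independent-down (τ⊆V , τ-indep) σ⊆τ =
    ⊆-trans σ⊆τ τ⊆V , λ E∈L E⊆σ → τ-indep E∈L (⊆-trans E⊆σ σ⊆τ)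

  independent-facet-above : ∀ {σ} → Independent L V σ →
    ∃ λ F → IsFacetOf (Independent L V) F × σ ⊆ F
  independent-facet-above = facet-above independent? independent-down

independent-⊆ : ∀ {L L′ : List (Subset n)} {V σ} → L′ ⊆ₗ L →
  Independent L V σ → Independent L′ V σ
independent-⊆ L′⊆L (σ⊆V , σ-indep) = σ⊆V , σ-indep ∘ L′⊆L

shelling-no-edges : ∀ {V : Subset n} → Shelling (IsFacetOf (Independent [] V))
shelling-no-edges {V = V} = record
  { facets   = V ∷ []
  ; sound    = λ { (Any.here refl) → (id , λ ()) , λ (V′⊆V , _) V⊆V′ → ⊆-antisym V′⊆V V⊆V′ }
  ; complete = λ ((F⊆V , _) , F-maximal) → Any.here (sym (F-maximal (id , λ ()) F⊆V))
  ; ordered  = (λ ()) ∷ []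
  }

shelling-empty-edge : ∀ {L : List (Subset n)} {V E} → E ∈ₗ L → Empty E →
  Shelling (IsFacetOf (Independent L V))
shelling-empty-edge E∈L E-empty = record
  { facets   = []
  ; sound    = λ ()
  ; complete = λ ((_ , F-indep) , _) → ⊥-elim (F-indep E∈L λ x∈E → ⊥-elim (E-empty (_ , x∈E)))
  ; ordered  = []
  }

_without_ : List (Subset n) → Subset n → List (Subset n)
L without H = filter (λ E′ → ¬? (E′ ≟ₛ H)) L

without-⊆ : ∀ (L : List (Subset n)) H → L without H ⊆ₗ L
without-⊆ L H = ⊆ₗ.filter-⊆ (λ E′ → ¬? (E′ ≟ₛ H)) L

length-without : ∀ {L : List (Subset n)} {H} → H ∈ₗ L → length (L without H) < length L
length-without {L = L} {H} H∈L =
  filter-notAll (λ E′ → ¬? (E′ ≟ₛ H)) L (Any.map (λ H≡E′ E′≢H → E′≢H (sym H≡E′)) H∈L)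

independent-without-superset : ∀ {L : List (Subset n)} {V E H σ} → E ∈ₗ L → H ≢ E → E ⊆ H →
  Independent (L without H) V σ → Independent L V σ
independent-without-superset {L = L} {H = H} {σ = σ} E∈L H≢E E⊆H (σ⊆V , σ-indep) = σ⊆V , no-edge
  where
  no-edge : ∀ {E′} → E′ ∈ₗ L → E′ ⊈ σ
  no-edge {E′} E′∈L E′⊆σ with E′ ≟ₛ H
  ... | yes refl = σ-indep (∈-filter⁺ _ E∈L (H≢E ∘ sym)) (⊆-trans E⊆H E′⊆σ)
  ... | no  E′≢H = σ-indep (∈-filter⁺ _ E′∈L E′≢H) E′⊆σ

shelling-without-superset : ∀ {L : List (Subset n)} {V E H} → E ∈ₗ L → H ≢ E → E ⊆ H →
  Shelling (IsFacetOf (Independent (L without H) V)) → Shelling (IsFacetOf (Independent L V))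
shelling-without-superset {L = L} {H = H} E∈L H≢E E⊆H = shelling-resp
  (IsFacetOf-resp (independent-without-superset E∈L H≢E E⊆H) (independent-⊆ (without-⊆ L H)))
  (IsFacetOf-resp (independent-⊆ (without-⊆ L H)) (independent-without-superset E∈L H≢E E⊆H))

Within : List (Subset n) → Subset n → Set
Within L V = ∀ {E} → E ∈ₗ L → E ⊆ V

Within-map-─ : ∀ {L : List (Subset n)} {V} J → Within L V → Within (map (_─ J) L) (V ─ J)
Within-map-─ J L⊆V E∈ with ∈-map⁻ (_─ J) E∈
... | E′ , E′∈L , refl = ─-monoˡ-⊆ (L⊆V E′∈L)

-- Δ₁ is the link of v; the facets of Δ avoiding v all contain E - v, and removing it leaves the
-- facets of Δ₂.
module FreeVertex {n} {L : List (Subset n)} {V E : Subset n} {v : Fin n}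
  (E∈L : E ∈ₗ L) (E⊆V : E ⊆ V) (v∈E : v ∈ E)
  (v-free : ∀ {E′} → E′ ∈ₗ L → v ∈ E′ → E′ ≡ E)
  where

  Δ : Subset n → Set
  Δ = Independent L V

  avoids-v? : Decidable (v ∉_)
  avoids-v? E′ = ¬? (v ∈? E′)

  avoiding-v : List (Subset n)
  avoiding-v = filter avoids-v? L

  Δ₁ Δ₂ : Subset n → Set
  Δ₁ = Independent (map (_- v) L) (V - v)
  Δ₂ = Independent (map (_─ E) avoiding-v) (V ─ E)

  v∈V : v ∈ V
  v∈V = E⊆V v∈E

  add-v : ∀ {σ} → Δ σ → E - v ⊈ σ → Δ (σ ∪ ⁅ v ⁆)
  add-v {σ} (σ⊆V , σ-indep) E-v⊈σ = ∪-lub σ⊆V (x∈p⇒⁅x⁆⊆p v∈V) , no-edge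
    where
    no-edge : ∀ {E′} → E′ ∈ₗ L → E′ ⊈ σ ∪ ⁅ v ⁆
    no-edge {E′} E′∈L E′⊆σ+v with v ∈? E′
    ... | yes v∈E′ = E-v⊈σ (p⊆r∪q⇒p─q⊆r (subst (_⊆ σ ∪ ⁅ v ⁆) (v-free E′∈L v∈E′) E′⊆σ+v))
    ... | no  v∉E′ = σ-indep E′∈L (⊆-trans (x∉p⇒p⊆p-x v∉E′) (p⊆r∪q⇒p─q⊆r E′⊆σ+v))

  facet-avoiding-v : ∀ {M} → IsFacetOf Δ M → v ∉ M → E - v ⊆ M
  facet-avoiding-v {M} (ΔM , M-maximal) v∉M = decidable-stable (E - v ⊆? M) λ E-v⊈M →
    v∉M (subst (v ∈_) (M-maximal (add-v ΔM E-v⊈M) (p⊆p∪q ⁅ v ⁆)) (q⊆p∪q M ⁅ v ⁆ (x∈⁅x⁆ v)))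

  link-join : ∀ {τ} → Δ₁ τ → Δ (τ ∪ ⁅ v ⁆) × v ∈ τ ∪ ⁅ v ⁆
  link-join {τ} (τ⊆V-v , τ-indep) =
    (∪-lub (⊆-trans τ⊆V-v (p─q⊆p V ⁅ v ⁆)) (x∈p⇒⁅x⁆⊆p v∈V) ,
     λ E′∈L E′⊆τ+v → τ-indep (∈-map⁺ (_- v) E′∈L) (p⊆r∪q⇒p─q⊆r E′⊆τ+v)) ,
    q⊆p∪q τ ⁅ v ⁆ (x∈⁅x⁆ v)

  link-split : ∀ {ρ} → Δ ρ → v ∈ ρ → Δ₁ (ρ - v)
  link-split {ρ} (ρ⊆V , ρ-indep) v∈ρ = ─-monoˡ-⊆ ρ⊆V , no-edge
    where
    no-edge : ∀ {E″} → E″ ∈ₗ map (_- v) L → E″ ⊈ ρ - v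
    no-edge E″∈ E″⊆ρ-v with ∈-map⁻ (_- v) E″∈
    ... | E′ , E′∈L , refl = ρ-indep E′∈L
      (p─q⊆r⇒q⊆r⇒p⊆r (⊆-trans E″⊆ρ-v (p─q⊆p ρ ⁅ v ⁆)) (x∈p⇒⁅x⁆⊆p v∈ρ))

  link-upward : ∀ {ρ ρ′} → v ∈ ρ → ρ ⊆ ρ′ → Δ ρ′ → v ∈ ρ′
  link-upward v∈ρ ρ⊆ρ′ _ = ρ⊆ρ′ v∈ρ

  link-disjoint : ∀ {τ} → Δ₁ τ → Empty (τ ∩ ⁅ v ⁆)
  link-disjoint (τ⊆V-v , _) = p⊆q─r⇒Empty[p∩r] τ⊆V-v

  module Link = FacetsOfJoin ⁅ v ⁆ link-upward x∈p⇒⁅x⁆⊆p link-disjoint link-join link-split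

  Omits-v-from-E : Subset n → Set
  Omits-v-from-E ρ = E - v ⊆ ρ × v ∉ ρ

  rest-upward : ∀ {ρ ρ′} → Omits-v-from-E ρ → ρ ⊆ ρ′ → Δ ρ′ → Omits-v-from-E ρ′
  rest-upward (E-v⊆ρ , _) ρ⊆ρ′ (_ , ρ′-indep) = E-v⊆ρ′ , λ v∈ρ′ →
    ρ′-indep E∈L (p─q⊆r⇒q⊆r⇒p⊆r E-v⊆ρ′ (x∈p⇒⁅x⁆⊆p v∈ρ′))
    where E-v⊆ρ′ = ⊆-trans E-v⊆ρ ρ⊆ρ′

  rest-disjoint : ∀ {τ} → Δ₂ τ → Empty (τ ∩ (E - v))
  rest-disjoint (τ⊆V─E , _) = p⊆q─r⇒Empty[p∩r] (⊆-trans τ⊆V─E (─-antimonoʳ-⊆ (p─q⊆p E ⁅ v ⁆)))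

  rest-join : ∀ {τ} → Δ₂ τ → Δ (τ ∪ (E - v)) × Omits-v-from-E (τ ∪ (E - v))
  rest-join {τ} (τ⊆V─E , τ-indep) =
    (∪-lub (⊆-trans τ⊆V─E (p─q⊆p V E)) (⊆-trans (p─q⊆p E ⁅ v ⁆) E⊆V) , no-edge) ,
    q⊆p∪q τ (E - v) , v∉τ+E-v
    where
    v∉τ+E-v : v ∉ τ ∪ (E - v)
    v∉τ+E-v v∈ = [ (λ v∈τ → x∈p─q⇒x∉q V E (τ⊆V─E v∈τ) v∈E)
                 , (λ v∈E-v → x∈p─q⇒x∉q E ⁅ v ⁆ v∈E-v (x∈⁅x⁆ v)) ]′ (x∈p∪q⁻ τ (E - v) v∈)
    no-edge : ∀ {E′} → E′ ∈ₗ L → E′ ⊈ τ ∪ (E - v)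
    no-edge {E′} E′∈L E′⊆ with v ∈? E′
    ... | yes v∈E′ = v∉τ+E-v (E′⊆ v∈E′)
    ... | no  v∉E′ = τ-indep (∈-map⁺ (_─ E) (∈-filter⁺ _ E′∈L v∉E′))
      (p⊆r∪q⇒p─q⊆r (⊆-trans E′⊆ (∪-mono-⊆ id (p─q⊆p E ⁅ v ⁆))))

  rest-split : ∀ {ρ} → Δ ρ → Omits-v-from-E ρ → Δ₂ (ρ ─ (E - v))
  rest-split {ρ} (ρ⊆V , ρ-indep) (E-v⊆ρ , v∉ρ) = within , no-edge
    where
    within : ρ ─ (E - v) ⊆ V ─ E
    within x∈ = x∈p∧x∉q⇒x∈p─q (ρ⊆V (p─q⊆p ρ _ x∈)) λ x∈E →
      x∈p─q⇒x∉q ρ (E - v) x∈ (x∈p∧x≢y⇒x∈p-y x∈E λ { refl → v∉ρ (p─q⊆p ρ _ x∈) })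
    no-edge : ∀ {E″} → E″ ∈ₗ map (_─ E) avoiding-v → E″ ⊈ ρ ─ (E - v)
    no-edge E″∈ E″⊆ with ∈-map⁻ (_─ E) E″∈
    ... | E′ , E′∈ , refl = ρ-indep E′∈L E′⊆ρ
      where
      E′∈L = proj₁ (∈-filter⁻ _ {xs = L} E′∈)
      v∉E′ = proj₂ (∈-filter⁻ _ {xs = L} E′∈)
      E′⊆ρ : E′ ⊆ ρ
      E′⊆ρ {x} x∈E′ with x ∈? E
      ... | yes x∈E = E-v⊆ρ (x∈p∧x≢y⇒x∈p-y x∈E λ { refl → v∉E′ x∈E′ })
      ... | no  x∉E = p─q⊆p ρ _ (E″⊆ (x∈p∧x∉q⇒x∈p─q x∈E′ x∉E))

  module Rest = FacetsOfJoin (E - v) rest-upward proj₁ rest-disjoint rest-join rest-split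

  -- (F - u) ∪ {v} is independent because it misses u ∈ E, and every facet above it meets F in F - u.
  exchange : ∀ {F u} → Δ F → E - v ⊆ F → u ∈ E - v →
    ∃ λ M → (IsFacetOf Δ M × v ∈ M) × F ─ M ≡ ⁅ u ⁆
  exchange {F} {u} ΔF E-v⊆F u∈E-v
    with independent-facet-above (add-v (independent-down ΔF (p─q⊆p F ⁅ u ⁆)) E-v⊈F-u)
    where
    E-v⊈F-u : E - v ⊈ F - u
    E-v⊈F-u E-v⊆F-u = x∈p─q⇒x∉q F ⁅ u ⁆ (E-v⊆F-u u∈E-v) (x∈⁅x⁆ u)
  ... | M , M-facet , F-u+v⊆M =
    M , (M-facet , v∈M) , ⊆-antisym (p─q⊆r⇒p─r⊆q F-u⊆M) (x∈p⇒⁅x⁆⊆p (x∈p∧x∉q⇒x∈p─q (E-v⊆F u∈E-v) u∉M))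
    where
    v∈M : v ∈ M
    v∈M = F-u+v⊆M (q⊆p∪q (F - u) ⁅ v ⁆ (x∈⁅x⁆ v))
    F-u⊆M : F - u ⊆ M
    F-u⊆M = ⊆-trans (p⊆p∪q ⁅ v ⁆) F-u+v⊆M
    u∉M : u ∉ M
    u∉M u∈M = proj₂ (proj₁ M-facet) E∈L
      (p─q⊆r⇒q⊆r⇒p⊆r (⊆-trans E-v⊆F (p─q⊆r⇒q⊆r⇒p⊆r F-u⊆M (x∈p⇒⁅x⁆⊆p u∈M))) (x∈p⇒⁅x⁆⊆p v∈M))

  attaches-to-link : ∀ {F G} → Δ F → E - v ⊆ F → Δ G → v ∈ G →
    Attaches (λ M → IsFacetOf Δ M × v ∈ M) F G
  attaches-to-link ΔF E-v⊆F (_ , G-indep) v∈G with p⊈q⇒∃ (G-indep E∈L)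
  ... | u , u∈E , u∉G = u , x∈p∧x∉q⇒x∈p─q (E-v⊆F u∈E-v) u∉G , exchange ΔF E-v⊆F u∈E-v
    where
    u∈E-v : u ∈ E - v
    u∈E-v = x∈p∧x≢y⇒x∈p-y u∈E λ { refl → u∉G v∈G }

  shelling-shed : Shelling (IsFacetOf Δ₁) → Shelling (IsFacetOf Δ₂) → Shelling (IsFacetOf Δ)
  shelling-shed sh₁ sh₂ =
    shelling-resp [ proj₁ , proj₁ ]′ by-v (shelling-++ (Link.shelling-join sh₁) (Rest.shelling-join sh₂) attaches)
    where
    by-v : ∀ {M} → IsFacetOf Δ M → (IsFacetOf Δ M × v ∈ M) ⊎ (IsFacetOf Δ M × Omits-v-from-E M)
    by-v {M} M-facet with v ∈? M
    ... | yes v∈M = inj₁ (M-facet , v∈M)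
    ... | no  v∉M = inj₂ (M-facet , facet-avoiding-v M-facet v∉M , v∉M)
    attaches : ∀ {F G} → IsFacetOf Δ F × Omits-v-from-E F → IsFacetOf Δ G × v ∈ G →
      Attaches (λ M → IsFacetOf Δ M × v ∈ M) F G
    attaches ((ΔF , _) , E-v⊆F , _) ((ΔG , _) , v∈G) = attaches-to-link ΔF E-v⊆F ΔG v∈G

∈⇒≢[] : ∀ {A : Set} {x : A} {xs} → x ∈ₗ xs → xs ≢ []
∈⇒≢[] (Any.here _)  ()
∈⇒≢[] (Any.there _) ()

≢[]⇒∈ : ∀ {A : Set} {xs : List A} → xs ≢ [] → ∃ (_∈ₗ xs)
≢[]⇒∈ {xs = []}    []≢[] = ⊥-elim ([]≢[] refl)
≢[]⇒∈ {xs = x ∷ _} _     = x , Any.here refl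

record Transversal {A B : Set} (f : A → B) (L : List A) (S : List B) : Set where
  field
    reps      : List A
    reps⊆L    : reps ⊆ₗ L
    image⊆S   : ∀ {t} → t ∈ₗ reps → f t ∈ₗ S
    covers    : ∀ {s} → s ∈ₗ S → ∃ λ t → t ∈ₗ reps × f t ≡ s
    injective : ∀ {t t′} → t ∈ₗ reps → t′ ∈ₗ reps → f t ≡ f t′ → t ≡ t′

module _ {A B : Set} {f : A → B} {L : List A} {S : List B} (T : Transversal f L S) where
  open Transversal T

  transversal-∷-covered : ∀ {s} → Any (λ t → f t ≡ s) reps → Transversal f L (s ∷ S)
  transversal-∷-covered {s} s-covered = record
    { reps = reps ; reps⊆L = reps⊆L ; image⊆S = Any.there ∘ image⊆S ; covers = covers′ ; injective = injective }
    where
    covers′ : ∀ {s′} → s′ ∈ₗ s ∷ S → ∃ λ t → t ∈ₗ reps × f t ≡ s′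
    covers′ (Any.here refl)  = find s-covered
    covers′ (Any.there s′∈) = covers s′∈

  transversal-∷-new : ∀ {t₀} → t₀ ∈ₗ L → ¬ Any (λ t → f t ≡ f t₀) reps → Transversal f L (f t₀ ∷ S)
  transversal-∷-new {t₀} t₀∈L t₀-new = record
    { reps = t₀ ∷ reps ; reps⊆L = reps⊆L′ ; image⊆S = image⊆S′ ; covers = covers′ ; injective = injective′ }
    where
    reps⊆L′ : t₀ ∷ reps ⊆ₗ L
    reps⊆L′ (Any.here refl) = t₀∈L
    reps⊆L′ (Any.there t∈)  = reps⊆L t∈
    image⊆S′ : ∀ {t} → t ∈ₗ t₀ ∷ reps → f t ∈ₗ f t₀ ∷ S
    image⊆S′ (Any.here refl) = Any.here refl
    image⊆S′ (Any.there t∈)  = Any.there (image⊆S t∈)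
    covers′ : ∀ {s′} → s′ ∈ₗ f t₀ ∷ S → ∃ λ t → t ∈ₗ t₀ ∷ reps × f t ≡ s′
    covers′ (Any.here refl) = t₀ , Any.here refl , refl
    covers′ (Any.there s′∈) with covers s′∈
    ... | t , t∈ , ft≡s′ = t , Any.there t∈ , ft≡s′
    injective′ : ∀ {t t′} → t ∈ₗ t₀ ∷ reps → t′ ∈ₗ t₀ ∷ reps → f t ≡ f t′ → t ≡ t′
    injective′ (Any.here refl) (Any.here refl) _  = refl
    injective′ (Any.here refl) (Any.there t′∈) eq = ⊥-elim (t₀-new (lose t′∈ (sym eq)))
    injective′ (Any.there t∈)  (Any.here refl) eq = ⊥-elim (t₀-new (lose t∈ eq))
    injective′ (Any.there t∈)  (Any.there t′∈) eq = injective t∈ t′∈ eq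

transversal : ∀ {A B : Set} (f : A → B) → DecidableEquality B → ∀ {L S} →
  S ⊆ₗ map f L → Transversal f L S
transversal f _ {S = []} _ =
  record { reps = [] ; reps⊆L = λ () ; image⊆S = λ () ; covers = λ () ; injective = λ () }
transversal f _≟_ {S = s ∷ S} s∷S⊆ with transversal f _≟_ (s∷S⊆ ∘ Any.there)
... | T with Any.any? (λ t → f t ≟ s) (Transversal.reps T) | ∈-map⁻ f (s∷S⊆ (Any.here refl))
...   | yes s-covered   | _               = transversal-∷-covered T s-covered
...   | no  s-uncovered | _ , t₀∈L , refl = transversal-∷-new T t₀∈L s-uncovered

-- Membership-based f-forests: duplicates and order of the subclutter are irrelevant.
Forest : List (Subset n) → Set
Forest {n} L = ∀ (S : List (Subset n)) → S ⊆ₗ L → S ≢ [] → ∃ (IsFLeaf S)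

forest-⊆ : ∀ {L L′ : List (Subset n)} → L′ ⊆ₗ L → Forest L → Forest L′
forest-⊆ L′⊆L forest S S⊆L′ = forest S (L′⊆L ∘ S⊆L′)

IsFLeaf-resp : ∀ {S S′ : List (Subset n)} {E} → S ⊆ₗ S′ → S′ ⊆ₗ S → IsFLeaf S E → IsFLeaf S′ E
IsFLeaf-resp S⊆S′ S′⊆S (E∈ , inj₁ E-only) = S⊆S′ E∈ , inj₁ (E-only ∘ S′⊆S)
IsFLeaf-resp S⊆S′ S′⊆S (E∈ , inj₂ (H , H∈ , H≢E , E∩⊆E∩H)) =
  S⊆S′ E∈ , inj₂ (H , S⊆S′ H∈ , H≢E , E∩⊆E∩H ∘ S′⊆S)

fforest⇒forest : (C : Clutter n) → IsFForest C → Forest (edges C)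
fforest⇒forest C fforest S S⊆ S≢[] with fforest (filter ∈S? (edges C)) (Sublist.filter-⊆ ∈S? (edges C)) S′≢[]
  where
  ∈S? : Decidable (_∈ₗ S)
  ∈S? E = Any.any? (E ≟ₛ_) S
  S′≢[] : filter ∈S? (edges C) ≢ []
  S′≢[] = let (E , E∈S) = ≢[]⇒∈ S≢[] in ∈⇒≢[] (∈-filter⁺ ∈S? (S⊆ E∈S) E∈S)
... | E , E-leaf =
  E , IsFLeaf-resp (λ E′∈ → proj₂ (∈-filter⁻ _ {xs = edges C} E′∈)) (λ E′∈S → ∈-filter⁺ _ (S⊆ E′∈S) E′∈S) E-leaf

module _ {L S : List (Subset n)} (J : Subset n) (T : Transversal (_─ J) L S) where
  open Transversal T

  IsFLeaf-image : ∀ {X} → IsFLeaf reps X → IsFLeaf S (X ─ J)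
  IsFLeaf-image {X} (X∈ , inj₁ X-only) = image⊆S X∈ , inj₁ only
    where
    only : ∀ {s} → s ∈ₗ S → s ≡ X ─ J
    only s∈S with covers s∈S
    ... | t , t∈ , refl = cong (_─ J) (X-only t∈)
  IsFLeaf-image {X} (X∈ , inj₂ (Y , Y∈ , Y≢X , X∩⊆X∩Y)) =
    image⊆S X∈ , inj₂ (Y ─ J , image⊆S Y∈ , Y≢X ∘ injective Y∈ X∈ , below)
    where
    below : ∀ {s} → s ∈ₗ S → s ≢ X ─ J → (X ─ J) ∩ s ⊆ (X ─ J) ∩ (Y ─ J)
    below s∈S s≢ with covers s∈S
    ... | t , t∈ , refl = ─-preserves-∩⊆∩ (X∩⊆X∩Y t∈ (s≢ ∘ cong (_─ J)))

forest-map-─ : ∀ {L : List (Subset n)} J → Forest L → Forest (map (_─ J) L)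
forest-map-─ J forest S S⊆ S≢[] with transversal (_─ J) _≟ₛ_ S⊆
... | T with forest (Transversal.reps T) (Transversal.reps⊆L T) reps≢[]
  where
  reps≢[] : Transversal.reps T ≢ []
  reps≢[] = let (s , s∈S) = ≢[]⇒∈ S≢[] in ∈⇒≢[] (proj₁ (proj₂ (Transversal.covers T s∈S)))
...   | X , X-leaf = X ─ J , IsFLeaf-image J T X-leaf

data LeafCase {n} (L : List (Subset n)) : Set where
  empty-edge  : ∀ {E} → E ∈ₗ L → Empty E → LeafCase L
  superset    : ∀ {E H} → E ∈ₗ L → H ∈ₗ L → H ≢ E → E ⊆ H → LeafCase L
  free-vertex : ∀ {E v} → E ∈ₗ L → v ∈ E → (∀ {E′} → E′ ∈ₗ L → v ∈ E′ → E′ ≡ E) → LeafCase L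

leaf-case : ∀ {L : List (Subset n)} {E} → IsFLeaf L E → LeafCase L
leaf-case {E = E} (E∈L , inj₁ E-only) with nonempty? E
... | yes (v , v∈E) = free-vertex E∈L v∈E (λ E′∈L _ → E-only E′∈L)
... | no  E-empty   = empty-edge E∈L E-empty
leaf-case {L = L} {E} (E∈L , inj₂ (H , H∈L , H≢E , E∩⊆E∩H)) with E ⊆? H
... | yes E⊆H = superset E∈L H∈L H≢E E⊆H
... | no  E⊈H with p⊈q⇒∃ E⊈H
...   | v , v∈E , v∉H = free-vertex E∈L v∈E only-E
  where
  only-E : ∀ {E′} → E′ ∈ₗ L → v ∈ E′ → E′ ≡ E
  only-E {E′} E′∈L v∈E′ = decidable-stable (E′ ≟ₛ E) λ E′≢E →
    v∉H (proj₂ (x∈p∩q⁻ E H (E∩⊆E∩H E′∈L E′≢E (x∈p∩q⁺ (v∈E , v∈E′)))))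

-- Shedding a free vertex shrinks V, dropping a superset edge shrinks L.
forest-shelling : ∀ {L : List (Subset n)} {V} → Acc _<_ (∣ V ∣ + length L) → Forest L → Within L V →
  Shelling (IsFacetOf (Independent L V))
forest-shelling {L = []} _ _ _ = shelling-no-edges
forest-shelling {L = L@(_ ∷ _)} {V} (acc smaller) forest L⊆V
  with leaf-case (proj₂ (forest L id λ ()))
... | empty-edge E∈L E-empty = shelling-empty-edge E∈L E-empty
... | superset {E} {H} E∈L H∈L H≢E E⊆H = shelling-without-superset E∈L H≢E E⊆H
  (forest-shelling (smaller (+-monoʳ-< ∣ V ∣ (length-without H∈L)))
    (forest-⊆ (without-⊆ L H) forest) (L⊆V ∘ without-⊆ L H))
... | free-vertex {E} {v} E∈L v∈E v-free =
  shelling-shed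
    (forest-shelling (smaller link-smaller) (forest-map-─ ⁅ v ⁆ forest) (Within-map-─ ⁅ v ⁆ L⊆V))
    (forest-shelling (smaller rest-smaller)
      (forest-map-─ E (forest-⊆ avoiding-v⊆L forest)) (Within-map-─ E (L⊆V ∘ avoiding-v⊆L)))
  where
  open FreeVertex E∈L (L⊆V E∈L) v∈E v-free
  avoiding-v⊆L : avoiding-v ⊆ₗ L
  avoiding-v⊆L = ⊆ₗ.filter-⊆ avoids-v? L
  link-smaller : ∣ V - v ∣ + length (map (_- v) L) < ∣ V ∣ + length L
  link-smaller = +-mono-<-≤ (x∈p⇒∣p-x∣<∣p∣ v∈V) (≤-reflexive (length-map (_- v) L))
  rest-smaller : ∣ V ─ E ∣ + length (map (_─ E) avoiding-v) < ∣ V ∣ + length L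
  rest-smaller = +-mono-<-≤ (p∩q≢∅⇒∣p─q∣<∣p∣ V E (v , x∈p∩q⁺ (v∈V , v∈E)))
    (≤-trans (≤-reflexive (length-map (_─ E) avoiding-v)) (length-filter avoids-v? L))

corollary5p6 : (n : ℕ) (C : Clutter n) → IsFForest C → IsShellable C
corollary5p6 n C fforest = shelling⇒isShellable C
  (shelling-resp (IsFacetOf-resp proj₂ independent) (IsFacetOf-resp independent proj₂)
    (forest-shelling (<-wellFounded _) (fforest⇒forest C fforest) (λ _ → ⊆⊤)))
  where
  independent : ∀ {σ} → IsFace C σ → Independent (edges C) ⊤ σ
  independent face = ⊆⊤ , face
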